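{- For all terms $M, N$: if $M\sim_{\alpha s} N$ then $M\sim_\alpha N$.
   Context: Let $\mathcal{V}$ (the variables) be a type with decidable equality, together with $\mathrm{encode}:\mathcal{V}\to\mathbb{N}$ and $\mathrm{decode}:\mathbb{N}\to\mathcal{V}$ with $\mathrm{encode}(\mathrm{decode}\,n)=n$. Let $\mathcal{C}$ be any type. Terms: $\mathsf{c}\,k$ ($k\in\mathcal{C}$), $\mathsf{v}\,x$, $\lambda[x:A]M$, $\Pi[x:A]B$, $M\cdot N$. Free variables (list): $\mathrm{fv}(\mathsf{c}\,k)=[\,]$, $\mathrm{fv}(\mathsf{v}\,x)=[x]$, $\mathrm{fv}(\lambda[x:A]M)=\mathrm{fv}\,A \mathbin{++} (\mathrm{fv}\,M - x)$, likewise for $\Pi$, $\mathrm{fv}(M\cdot N)=\mathrm{fv}\,M\mathbin{++}\mathrm{fv}\,N$, where $xs-x$ deletes every occurrence of $x$. Substitutions are functions $\sigma:\mathcal{V}\to\Lambda$; $\iota\,x=\mathsf{v}\,x$; $(\sigma,x:=N)$ maps $x$ to $N$ and $y\ne x$ to $\sigma\,y$. Fix $\chi':\mathrm{List}\,\mathbb{N}\to\mathbb{N}$ with $\chi'(ns)\notin ns$; $X'(xs)=\mathrm{decode}(\chi'(\mathrm{map}\ \mathrm{encode}\ xs))$; $X(\sigma,xs)=X'$ of the concatenation of the $\mathrm{fv}(\sigma\,y)$, $y$ in $xs$. Substitution: $\mathsf{c}\,k\bullet\sigma=\mathsf{c}\,k$; $\mathsf{v}\,x\bullet\sigma=\sigma\,x$;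 $(M\cdot N)\bullet\sigma=(M\bullet\sigma)\cdot(N\bullet\sigma)$; $(\lambda[x:A]M)\bullet\sigma=\lambda[y:A\bullet\sigma](M\bullet(\sigma,x:=\mathsf{v}\,y))$ with $y=X(\sigma,\mathrm{fv}\,M-x)$; analogously for $\Pi$. Write $M[x:=N]=M\bullet(\iota,x:=N)$. Alpha-conversion $\sim_\alpha$ is inductive with rules: $\mathsf{c}\,k\sim_\alpha\mathsf{c}\,k$; $\mathsf{v}\,x\sim_\alpha\mathsf{v}\,x$; $M\sim_\alpha M'$, $N\sim_\alpha N'$ give $M\cdot N\sim_\alpha M'\cdot N'$; if $A\sim_\alpha A'$, $y\notin\mathrm{fv}\,M-x$, $y\notin \mathrm{fv}\,M'-x'$ and $M[x:=\mathsf{v}\,y]= M'[x':=\mathsf{v}\,y]$ (syntactic equality), then $\lambda[x:A]M\sim_\alpha\lambda[x':A']M'$; same rule for $\Pi$. The relation $\sim_{\alpha s}$ is defined inductively by exactly the same rules, except that in the $\lambda$ and $\Pi$ rules the premise on the bodies is $M[x:=\mathsf{v}\,y]\sim_{\alpha s} M'[x':=\mathsf{v}\,y]$ instead of syntactic equality (with $A\sim_{\alpha s}A'$ and the same freshness conditions on $y$). -}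

module Defs where

open import Data.Nat using (ℕ)
open import Data.List using (List; []; _∷_; _++_; map; concatMap; filter)
open import Data.List.Membership.Propositional using (_∈_; _∉_)
open import Relation.Binary.PropositionalEquality using (_≡_; refl)
open import Relation.Binary.Definitions using (DecidableEquality)
open import Relation.Nullary using (¬_; Dec; yes; no)
open import Relation.Nullary.Decidable using (¬?)

module Lambda
  (V : Set) (_≟_ : DecidableEquality V)
  (encode : V → ℕ) (decode : ℕ → V)
  (encode-decode : ∀ n → encode (decode n) ≡ n)
  (C : Set)
  (χ' : List ℕ → ℕ) (χ'-fresh : ∀ ns → χ' ns ∉ ns)
  where

  data Λ : Set where
    c   : C → Λ
    v   : V → Λ
    lam : V → Λ → Λ → Λ   -- lam x A M  =  λ[x:A]M
    pi  : V → Λ → Λ → Λ   -- pi  x A B  =  Π[x:A]B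
    _·_ : Λ → Λ → Λ

  _-_ : List V → V → List V
  xs - x = filter (λ y → ¬? (y ≟ x)) xs

  fv : Λ → List V
  fv (c k)       = []
  fv (v x)       = x ∷ []
  fv (lam x A M) = fv A ++ (fv M - x)
  fv (pi x A B)  = fv A ++ (fv B - x)
  fv (M · N)     = fv M ++ fv N

  Subst : Set
  Subst = V → Λ

  ι : Subst
  ι x = v x

  _,_≔_ : Subst → V → Λ → Subst
  (σ , x ≔ N) y with y ≟ x
  ... | yes _ = N
  ... | no  _ = σ y

  X' : List V → V
  X' xs = decode (χ' (map encode xs))

  X : Subst → List V → V
  X σ xs = X' (concatMap (λ y → fv (σ y)) xs)

  _•_ : Λ → Subst → Λ
  c k       • σ = c k
  v x       • σ = σ x
  (M · N)   • σ = (M • σ) · (N • σ)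
  lam x A M • σ = let y = X σ (fv M - x) in lam y (A • σ) (M • (σ , x ≔ v y))
  pi  x A B • σ = let y = X σ (fv B - x) in pi  y (A • σ) (B • (σ , x ≔ v y))

  _[_≔_] : Λ → V → Λ → Λ
  M [ x ≔ N ] = M • (ι , x ≔ N)

  data _∼α_ : Λ → Λ → Set where
    ∼c   : ∀ k → c k ∼α c k
    ∼v   : ∀ x → v x ∼α v x
    ∼app : ∀ {M M' N N'} → M ∼α M' → N ∼α N' → (M · N) ∼α (M' · N')
    ∼lam : ∀ {x x' y A A' M M'} → A ∼α A' → y ∉ (fv M - x) → y ∉ (fv M' - x')
         → M [ x ≔ v y ] ≡ M' [ x' ≔ v y ] → lam x A M ∼α lam x' A' M'
    ∼pi  : ∀ {x x' y A A' M M'} → A ∼α A' → y ∉ (fv M - x) → y ∉ (fv M' - x')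
         → M [ x ≔ v y ] ≡ M' [ x' ≔ v y ] → pi x A M ∼α pi x' A' M'

  data _∼αs_ : Λ → Λ → Set where
    ∼c   : ∀ k → c k ∼αs c k
    ∼v   : ∀ x → v x ∼αs v x
    ∼app : ∀ {M M' N N'} → M ∼αs M' → N ∼αs N' → (M · N) ∼αs (M' · N')
    ∼lam : ∀ {x x' y A A' M M'} → A ∼αs A' → y ∉ (fv M - x) → y ∉ (fv M' - x')
         → (M [ x ≔ v y ]) ∼αs (M' [ x' ≔ v y ]) → lam x A M ∼αs lam x' A' M'
    ∼pi  : ∀ {x x' y A A' M M'} → A ∼αs A' → y ∉ (fv M - x) → y ∉ (fv M' - x')
         → (M [ x ≔ v y ]) ∼αs (M' [ x' ≔ v y ]) → pi x A M ∼αs pi x' A' M'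

-- Bound names in M • σ are chosen canonically by X, from the free variables of the
-- body alone, so M • σ is an invariant of the α-class of M.  Induction on an
-- ∼αs-derivation shows M • σ ≡ N • σ for every σ: renaming a bound x to the
-- fresh z of the derivation and then z to the canonical name is the same as
-- renaming x to the canonical name directly.  Conversely M • ι ≡ N • ι unfolds, at
-- each binder, to the premise of the ∼α rule with witness the canonical X ι (fv M - x).
module Submission where

open import Data.Empty using (⊥-elim)
open import Data.List using (List; []; _∷_; _++_; map; concat; concatMap)
open import Data.List.Effectful using (module MonadProperties)
open import Data.List.Membership.Propositional using (_∈_; _∉_)
open import Data.List.Membership.Propositional.Properties
  using (∈-++⁺ˡ; ∈-++⁺ʳ; ∈-map⁺; ∈-concat⁺′; ∈-filter⁺)
open import Data.List.Properties
  using (++-identityʳ; concatMap-++; concatMap-cong; concatMap-pure; map-cong-local;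
         filter-++; filter-all; filter-reject)
open import Data.List.Relation.Unary.All as All using ()
open import Data.List.Relation.Unary.Any using (here; there)
open import Data.Nat using (ℕ)
open import Data.Product using (_×_; _,_)
open import Function using (_∘_)
open import Relation.Binary.Definitions using (DecidableEquality)
open import Relation.Binary.PropositionalEquality
open import Relation.Nullary using (yes; no)
open import Relation.Nullary.Decidable using (¬?)

open import Defs

cong₃ : ∀ {A B C D : Set} (f : A → B → C → D) {a a' b b' c c'} →
        a ≡ a' → b ≡ b' → c ≡ c' → f a b c ≡ f a' b' c'
cong₃ f refl refl refl = refl

module _
  (V : Set) (_≟_ : DecidableEquality V)
  (encode : V → ℕ) (decode : ℕ → V)
  (encode-decode : ∀ n → encode (decode n) ≡ n)
  (C : Set)
  (χ' : List ℕ → ℕ) (χ'-fresh : ∀ ns → χ' ns ∉ ns)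
  where

  open Lambda V _≟_ encode decode encode-decode C χ' χ'-fresh
  open ≡-Reasoning

  remove-∉ : ∀ {z} xs → z ∉ xs → xs - z ≡ xs
  remove-∉ {z} xs z∉ =
    filter-all (λ y → ¬? (y ≟ z)) (All.tabulate λ y∈ y≡z → z∉ (subst (_∈ xs) y≡z y∈))

  ∈-remove⁺ : ∀ {z x xs} → z ∈ xs → z ≢ x → z ∈ xs - x
  ∈-remove⁺ {x = x} = ∈-filter⁺ (λ y → ¬? (y ≟ x))

  ≔-same : ∀ σ x N → (σ , x ≔ N) x ≡ N
  ≔-same σ x N with x ≟ x
  ... | yes _  = refl
  ... | no x≢x = ⊥-elim (x≢x refl)

  ≔-other : ∀ σ {x} N {y} → y ≢ x → (σ , x ≔ N) y ≡ σ y
  ≔-other σ {x} N {y} y≢x with y ≟ x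
  ... | yes y≡x = ⊥-elim (y≢x y≡x)
  ... | no _    = refl

  _≈_on_ : Subst → Subst → List V → Set
  σ ≈ τ on xs = ∀ {z} → z ∈ xs → σ z ≡ τ z

  _#_on_ : V → Subst → List V → Set
  y # σ on xs = ∀ {z} → z ∈ xs → y ∉ fv (σ z)

  binder : Subst → V → Λ → V
  binder σ x M = X σ (fv M - x)

  lift : Subst → V → Λ → Subst
  lift σ x M = σ , x ≔ v (binder σ x M)

  X'-fresh : ∀ xs → X' xs ∉ xs
  X'-fresh xs x∈ =
    χ'-fresh (map encode xs) (subst (_∈ map encode xs) (encode-decode _) (∈-map⁺ encode x∈))

  X-fresh : ∀ σ xs → X σ xs # σ on xs
  X-fresh σ xs z∈ y∈ = X'-fresh _ (∈-concat⁺′ y∈ (∈-map⁺ (fv ∘ σ) z∈))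

  #ι⇒∉ : ∀ {y xs} → y # ι on xs → y ∉ xs
  #ι⇒∉ y# y∈ = y# y∈ (here refl)

  ∉⇒#ι : ∀ {y xs} → y ∉ xs → y # ι on xs
  ∉⇒#ι y∉ z∈ (here refl) = y∉ z∈

  X-cong : ∀ {σ τ} xs → σ ≈ τ on xs → X σ xs ≡ X τ xs
  X-cong xs σ≈τ = cong (X' ∘ concat) (map-cong-local (All.tabulate (cong fv ∘ σ≈τ)))

  ≔-cong : ∀ {σ τ x N N'} xs → σ ≈ τ on (xs - x) → N ≡ N' → (σ , x ≔ N) ≈ (τ , x ≔ N') on xs
  ≔-cong {x = x} xs σ≈τ N≡N' {z} z∈ with z ≟ x
  ... | yes _   = N≡N'
  ... | no z≢x  = σ≈τ (∈-remove⁺ z∈ z≢x)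

  •-cong : ∀ M {σ τ} → σ ≈ τ on fv M → M • σ ≡ M • τ
  •-cong-binder : ∀ (b : V → Λ → Λ → Λ) x A M {σ τ} → σ ≈ τ on (fv A ++ (fv M - x)) →
    b (binder σ x M) (A • σ) (M • lift σ x M) ≡ b (binder τ x M) (A • τ) (M • lift τ x M)

  •-cong (c k)       σ≈τ = refl
  •-cong (v x)       σ≈τ = σ≈τ (here refl)
  •-cong (M · N)     σ≈τ = cong₂ _·_ (•-cong M (σ≈τ ∘ ∈-++⁺ˡ)) (•-cong N (σ≈τ ∘ ∈-++⁺ʳ (fv M)))
  •-cong (lam x A M)     = •-cong-binder lam x A M
  •-cong (pi x A M)      = •-cong-binder pi x A M

  •-cong-binder b x A M {σ} {τ} σ≈τ =
    cong₃ b y≡ (•-cong A (σ≈τ ∘ ∈-++⁺ˡ)) (•-cong M (≔-cong (fv M) body≈ (cong v y≡)))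
    where
    body≈ : σ ≈ τ on (fv M - x)
    body≈ = σ≈τ ∘ ∈-++⁺ʳ (fv A)
    y≡ : binder σ x M ≡ binder τ x M
    y≡ = X-cong (fv M - x) body≈

  concatMap-fv-rebind : ∀ σ x z xs → z # σ on (xs - x) →
    concatMap (fv ∘ (σ , x ≔ v z)) xs - z ≡ concatMap (fv ∘ σ) (xs - x)
  concatMap-fv-rebind σ x z []       z# = refl
  concatMap-fv-rebind σ x z (u ∷ xs) z# with u ≟ x
  ... | yes refl = trans (filter-reject (λ y → ¬? (y ≟ z)) (λ z≢z → z≢z refl))
                         (concatMap-fv-rebind σ x z xs z#)
  ... | no _     = trans (filter-++ (λ y → ¬? (y ≟ z)) (fv (σ u)) _)
                         (cong₂ _++_ (remove-∉ (fv (σ u)) (z# (here refl)))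
                                     (concatMap-fv-rebind σ x z xs (z# ∘ there)))

  fv-• : ∀ M σ → fv (M • σ) ≡ concatMap (fv ∘ σ) (fv M)
  fv-•-body : ∀ x M σ → fv (M • lift σ x M) - binder σ x M ≡ concatMap (fv ∘ σ) (fv M - x)

  fv-• (c k)       σ = refl
  fv-• (v x)       σ = sym (++-identityʳ (fv (σ x)))
  fv-• (M · N)     σ = trans (cong₂ _++_ (fv-• M σ) (fv-• N σ)) (sym (concatMap-++ (fv ∘ σ) (fv M) (fv N)))
  fv-• (lam x A M) σ = trans (cong₂ _++_ (fv-• A σ) (fv-•-body x M σ)) (sym (concatMap-++ (fv ∘ σ) (fv A) _))
  fv-• (pi x A M)  σ = trans (cong₂ _++_ (fv-• A σ) (fv-•-body x M σ)) (sym (concatMap-++ (fv ∘ σ) (fv A) _))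

  fv-•-body x M σ = trans (cong (_- binder σ x M) (fv-• M (lift σ x M)))
                          (concatMap-fv-rebind σ x _ (fv M) (X-fresh σ (fv M - x)))

  fv-•ι : ∀ M → fv (M • ι) ≡ fv M
  fv-•ι M = trans (fv-• M ι) (concatMap-pure (fv M))

  fv-[≔v] : ∀ M {x z} → z ∉ fv M - x → fv (M [ x ≔ v z ]) - z ≡ fv M - x
  fv-[≔v] M {x} {z} z∉ = begin
    fv (M [ x ≔ v z ]) - z                     ≡⟨ cong (_- z) (fv-• M (ι , x ≔ v z)) ⟩
    concatMap (fv ∘ (ι , x ≔ v z)) (fv M) - z  ≡⟨ concatMap-fv-rebind ι x z (fv M) (∉⇒#ι z∉) ⟩
    concatMap (fv ∘ ι) (fv M - x)              ≡⟨ concatMap-pure (fv M - x) ⟩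
    fv M - x                                   ∎

  _⨾_ : Subst → Subst → Subst
  (σ ⨾ τ) z = σ z • τ

  ⨾-≔ : ∀ {σ τ x y N N'} xs → y # σ on (xs - x) → N ≡ N' →
    ((σ , x ≔ v y) ⨾ (τ , y ≔ N)) ≈ ((σ ⨾ τ) , x ≔ N') on xs
  ⨾-≔ {σ} {τ} {x} {y} {N} xs y# N≡N' {z} z∈ with z ≟ x
  ... | yes _  = trans (≔-same τ y N) N≡N'
  ... | no z≢x = •-cong (σ z) λ u∈ → ≔-other τ N λ { refl → y# (∈-remove⁺ z∈ z≢x) u∈ }

  binder-⨾ : ∀ σ τ x M → binder τ (binder σ x M) (M • lift σ x M) ≡ binder (σ ⨾ τ) x M
  binder-⨾ σ τ x M = cong X' (begin
    concatMap (fv ∘ τ) (fv (M • lift σ x M) - binder σ x M)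
      ≡⟨ cong (concatMap (fv ∘ τ)) (fv-•-body x M σ) ⟩
    concatMap (fv ∘ τ) (concatMap (fv ∘ σ) (fv M - x))
      ≡⟨ MonadProperties.associative (fv M - x) (fv ∘ σ) (fv ∘ τ) ⟨
    concatMap (concatMap (fv ∘ τ) ∘ fv ∘ σ) (fv M - x)
      ≡⟨ concatMap-cong (λ z → sym (fv-• (σ z) τ)) (fv M - x) ⟩
    concatMap (fv ∘ (σ ⨾ τ)) (fv M - x)
      ∎)

  •-• : ∀ M σ τ → (M • σ) • τ ≡ M • (σ ⨾ τ)
  •-•-body : ∀ x M σ τ →
    (M • lift σ x M) • lift τ (binder σ x M) (M • lift σ x M) ≡ M • lift (σ ⨾ τ) x M

  •-• (c k)       σ τ = refl
  •-• (v x)       σ τ = refl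
  •-• (M · N)     σ τ = cong₂ _·_ (•-• M σ τ) (•-• N σ τ)
  •-• (lam x A M) σ τ = cong₃ lam (binder-⨾ σ τ x M) (•-• A σ τ) (•-•-body x M σ τ)
  •-• (pi x A M)  σ τ = cong₃ pi  (binder-⨾ σ τ x M) (•-• A σ τ) (•-•-body x M σ τ)

  •-•-body x M σ τ =
    trans (•-• M _ _) (•-cong M (⨾-≔ (fv M) (X-fresh σ (fv M - x)) (cong v (binder-⨾ σ τ x M))))

  [≔v]-• : ∀ M {x z} σ N → z ∉ fv M - x → (M [ x ≔ v z ]) • (σ , z ≔ N) ≡ M • (σ , x ≔ N)
  [≔v]-• M σ N z∉ = trans (•-• M _ _) (•-cong M (⨾-≔ (fv M) (∉⇒#ι z∉) refl))

  •-binder-≡ : ∀ (b : V → Λ → Λ → Λ) {x x' z A A' M M'} σ → A • σ ≡ A' • σ →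
    z ∉ fv M - x → z ∉ fv M' - x' → (∀ τ → (M [ x ≔ v z ]) • τ ≡ (M' [ x' ≔ v z ]) • τ) →
    b (binder σ x M) (A • σ) (M • lift σ x M) ≡ b (binder σ x' M') (A' • σ) (M' • lift σ x' M')
  •-binder-≡ b {x} {x'} {z} {M = M} {M'} σ A≡ z∉ z∉' M≡ = cong₃ b y≡y' A≡ (begin
    M • lift σ x M                      ≡⟨ [≔v]-• M σ (v y) z∉ ⟨
    (M [ x ≔ v z ]) • (σ , z ≔ v y)     ≡⟨ M≡ (σ , z ≔ v y) ⟩
    (M' [ x' ≔ v z ]) • (σ , z ≔ v y)   ≡⟨ [≔v]-• M' σ (v y) z∉' ⟩
    M' • (σ , x' ≔ v y)                 ≡⟨ cong (λ w → M' • (σ , x' ≔ v w)) y≡y' ⟩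
    M' • lift σ x' M'                   ∎)
    where
    y = binder σ x M
    free-≡ : fv M - x ≡ fv M' - x'
    free-≡ = begin
      fv M - x                        ≡⟨ fv-[≔v] M z∉ ⟨
      fv (M [ x ≔ v z ]) - z          ≡⟨ cong (_- z) (fv-•ι (M [ x ≔ v z ])) ⟨
      fv ((M [ x ≔ v z ]) • ι) - z    ≡⟨ cong (λ N → fv N - z) (M≡ ι) ⟩
      fv ((M' [ x' ≔ v z ]) • ι) - z  ≡⟨ cong (_- z) (fv-•ι (M' [ x' ≔ v z ])) ⟩
      fv (M' [ x' ≔ v z ]) - z        ≡⟨ fv-[≔v] M' z∉' ⟩
      fv M' - x'                      ∎
    y≡y' : y ≡ binder σ x' M'
    y≡y' = cong (X σ) free-≡

  ∼αs⇒•-≡ : ∀ {M N} → M ∼αs N → ∀ σ → M • σ ≡ N • σ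
  ∼αs⇒•-≡ (∼c k)       σ = refl
  ∼αs⇒•-≡ (∼v x)       σ = refl
  ∼αs⇒•-≡ (∼app M∼ N∼) σ = cong₂ _·_ (∼αs⇒•-≡ M∼ σ) (∼αs⇒•-≡ N∼ σ)
  ∼αs⇒•-≡ (∼lam {x} {x'} {z} {A} {A'} {M} {M'} A∼ z∉ z∉' M∼) σ =
    •-binder-≡ lam {x} {x'} {z} {A} {A'} {M} {M'} σ (∼αs⇒•-≡ A∼ σ) z∉ z∉' (∼αs⇒•-≡ M∼)
  ∼αs⇒•-≡ (∼pi {x} {x'} {z} {A} {A'} {M} {M'} A∼ z∉ z∉' M∼) σ =
    •-binder-≡ pi {x} {x'} {z} {A} {A'} {M} {M'} σ (∼αs⇒•-≡ A∼ σ) z∉ z∉' (∼αs⇒•-≡ M∼)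

  ·-injective : ∀ {M M' N N'} → M · N ≡ M' · N' → M ≡ M' × N ≡ N'
  ·-injective refl = refl , refl

  lam-injective : ∀ {y y' A A' M M'} → lam y A M ≡ lam y' A' M' → y ≡ y' × A ≡ A' × M ≡ M'
  lam-injective refl = refl , refl , refl

  pi-injective : ∀ {y y' A A' M M'} → pi y A M ≡ pi y' A' M' → y ≡ y' × A ≡ A' × M ≡ M'
  pi-injective refl = refl , refl , refl

  binder-ι-∉ : ∀ x M → binder ι x M ∉ fv M - x
  binder-ι-∉ x M = #ι⇒∉ (X-fresh ι (fv M - x))

  •ι-≡⇒∼α : ∀ M N → M • ι ≡ N • ι → M ∼α N
  •ι-≡⇒∼α (c k)       (c .k)        refl = ∼c k
  •ι-≡⇒∼α (v x)       (v .x)        refl = ∼v x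
  •ι-≡⇒∼α (M · N)     (M' · N')     eq with ·-injective eq
  ... | M≡ , N≡ = ∼app (•ι-≡⇒∼α M M' M≡) (•ι-≡⇒∼α N N' N≡)
  •ι-≡⇒∼α (lam x A M) (lam x' A' M') eq with lam-injective eq
  ... | y≡y' , A≡ , M≡ =
    ∼lam (•ι-≡⇒∼α A A' A≡) (binder-ι-∉ x M) (subst (_∉ fv M' - x') (sym y≡y') (binder-ι-∉ x' M'))
         (trans M≡ (cong (λ w → M' [ x' ≔ v w ]) (sym y≡y')))
  •ι-≡⇒∼α (pi x A M)  (pi x' A' M')  eq with pi-injective eq
  ... | y≡y' , A≡ , M≡ =
    ∼pi (•ι-≡⇒∼α A A' A≡) (binder-ι-∉ x M) (subst (_∉ fv M' - x') (sym y≡y') (binder-ι-∉ x' M'))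
        (trans M≡ (cong (λ w → M' [ x' ≔ v w ]) (sym y≡y')))
  •ι-≡⇒∼α (c _)       (v _)         ()
  •ι-≡⇒∼α (c _)       (lam _ _ _)   ()
  •ι-≡⇒∼α (c _)       (pi _ _ _)    ()
  •ι-≡⇒∼α (c _)       (_ · _)       ()
  •ι-≡⇒∼α (v _)       (c _)         ()
  •ι-≡⇒∼α (v _)       (lam _ _ _)   ()
  •ι-≡⇒∼α (v _)       (pi _ _ _)    ()
  •ι-≡⇒∼α (v _)       (_ · _)       ()
  •ι-≡⇒∼α (lam _ _ _) (c _)         ()
  •ι-≡⇒∼α (lam _ _ _) (v _)         ()
  •ι-≡⇒∼α (lam _ _ _) (pi _ _ _)    ()
  •ι-≡⇒∼α (lam _ _ _) (_ · _)       ()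
  •ι-≡⇒∼α (pi _ _ _)  (c _)         ()
  •ι-≡⇒∼α (pi _ _ _)  (v _)         ()
  •ι-≡⇒∼α (pi _ _ _)  (lam _ _ _)   ()
  •ι-≡⇒∼α (pi _ _ _)  (_ · _)       ()
  •ι-≡⇒∼α (_ · _)     (c _)         ()
  •ι-≡⇒∼α (_ · _)     (v _)         ()
  •ι-≡⇒∼α (_ · _)     (lam _ _ _)   ()
  •ι-≡⇒∼α (_ · _)     (pi _ _ _)    ()

  ∼αs⇒∼α : ∀ M N → M ∼αs N → M ∼α N
  ∼αs⇒∼α M N M∼N = •ι-≡⇒∼α M N (∼αs⇒•-≡ M∼N ι)

theorem2 : (V : Set) (_≟_ : DecidableEquality V)
    (encode : V → ℕ) (decode : ℕ → V)
    (encode-decode : ∀ n → encode (decode n) ≡ n)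
    (C : Set)
    (χ' : List ℕ → ℕ) (χ'-fresh : ∀ ns → χ' ns ∉ ns) →
    let open Lambda V _≟_ encode decode encode-decode C χ' χ'-fresh in
    ∀ (M N : Λ) → M ∼αs N → M ∼α N
theorem2 = ∼αs⇒∼α
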